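{- For every integer $n\geq 6$, $\sigma^{ - }(C_n^{2})=6$.
   Context: $C_n$ denotes the cycle on $n$ vertices $u_0,\dots,u_{n-1}$, and $C_n^2$ is its square: the graph on the same vertices in which $u_i$ is adjacent to $u_{i\pm1}$ and $u_{i\pm2}$ (indices mod $n$). For a graph $G$ on $n$ vertices, the rna number $\sigma^{ - }(G)$ is the minimum, over all partitions $V(G)=A\cup B$ with $A\cap B=\emptyset$ and $||A|-|B||\leq 1$, of the number of edges of $G$ with one endpoint in $A$ and the other in $B$ (equivalently, the least number of negative edges among all parity signed graphs over $G$). -}

module Defs where

open import Data.Nat using (ℕ; zero; suc; _+_; _∸_; _≤_; _<ᵇ_; _≡ᵇ_; NonZero)
open import Data.Nat.DivMod using (_%_)
open import Data.Bool using (Bool; true; false; _∧_; _∨_; not; _xor_; if_then_else_)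
open import Data.Fin using (Fin; toℕ)
open import Data.List using (List; map; allFin)
open import Data.Nat.ListAction using (sum)
open import Data.Product using (Σ; _×_)
open import Relation.Binary.PropositionalEquality using (_≡_)

⟦_⟧ : Bool → ℕ
⟦ true ⟧ = 1
⟦ false ⟧ = 0

ΣFin : (n : ℕ) → (Fin n → ℕ) → ℕ
ΣFin n f = sum (map f (allFin n))

-- Adjacency in C_n^2 (vertices u_0..u_{n-1} identified with Fin n):
-- u_i ~ u_j iff i ≠ j and j - i ≡ ±1 or ±2 (mod n).
sqAdj : (n : ℕ) → Fin n → Fin n → Bool
sqAdj zero () _
sqAdj (suc m) i j =
  let n = suc m
      d = (n + toℕ j ∸ toℕ i) % n
  in not (toℕ i ≡ᵇ toℕ j) ∧
     ((d ≡ᵇ 1) ∨ (d ≡ᵇ 2) ∨ (d ≡ᵇ (n ∸ 1)) ∨ (d ≡ᵇ (n ∸ 2)))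

-- A partition V = A ∪ B is a map p : Fin n → Bool (A = p⁻¹ true, B = p⁻¹ false).
sizeA : (n : ℕ) → (Fin n → Bool) → ℕ
sizeA n p = ΣFin n (λ i → ⟦ p i ⟧)

sizeB : (n : ℕ) → (Fin n → Bool) → ℕ
sizeB n p = ΣFin n (λ i → ⟦ not (p i) ⟧)

Balanced : (n : ℕ) → (Fin n → Bool) → Set
Balanced n p = (sizeA n p ≤ suc (sizeB n p)) × (sizeB n p ≤ suc (sizeA n p))

cutSq : (n : ℕ) → (Fin n → Bool) → ℕ
cutSq n p = ΣFin n (λ i → ΣFin n (λ j →
  ⟦ (toℕ i <ᵇ toℕ j) ∧ sqAdj n i j ∧ (p i xor p j) ⟧))

RnaSqIs : ℕ → ℕ → Set
RnaSqIs n k =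
  Σ (Fin n → Bool) (λ p → Balanced n p × cutSq n p ≡ k)
  × ((p : Fin n → Bool) → Balanced n p → k ≤ cutSq n p)

module Submission where

-- Read a partition as a periodic colouring y of ℕ.  Let B count the colour changes
-- y i ≠ y (i + 1), let b i = [y i ≠ y (i + 1)] and C count the changes of b, and let I count
-- the isolated vertices (b i = b (i + 1) = true).  Since y i ≠ y (i + 2) iff b i ≠ b (i + 1),
-- the cut is B + C; both are even, and summing ⟦u⟧ + ⟦v⟧ = ⟦u xor v⟧ + 2⟦u ∧ v⟧ over
-- u = b i, v = b (i + 1) gives 2B = C + 2I.  If both colour classes have two vertices, then
-- B ≥ 2; if B = 2, an isolated vertex would be alone in its class, so I = 0 and C = 4; if
-- B ≥ 4, either C ≥ 2 or b is constant, and then B = n ≥ 6.  Two arcs of lengths ⌊n/2⌋ and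
-- ⌈n/2⌉ attain the bound 6.  Grouping the edges {i, j}, i < j, by j − i ∈ {1, 2, n − 2, n − 1}
-- identifies cutSq with the cut of the periodic colouring.

open import Defs
open import Data.Nat using (ℕ; zero; suc; _+_; _*_; _∸_; _≤_; _<_; _<ᵇ_; _≡ᵇ_; z≤n; s≤s; NonZero; ⌊_/2⌋; ⌈_/2⌉)
open import Data.Nat.Properties
open import Data.Nat.DivMod using (_mod_; _%_; [m+n]%n≡m%n; m<n⇒m%n≡m)
open import Data.Nat.ListAction using (sum)
open import Data.Nat.Tactic.RingSolver using (solve-∀)
open import Data.Bool using (Bool; true; false; not; _∧_; _∨_; _xor_)
open import Data.Bool.Properties using (xor-assoc; xor-comm; xor-same; xor-identityʳ)
open import Data.Empty using (⊥-elim)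
open import Data.Fin as Fin using (Fin; toℕ)
open import Data.Fin.Properties using (toℕ<n; fromℕ<-toℕ; fromℕ<-cong)
open import Data.List using (tabulate)
open import Data.List.Properties using (map-tabulate)
open import Data.Product using (Σ; ∃-syntax; _×_; _,_; proj₁; proj₂)
open import Data.Sum using (_⊎_; inj₁; inj₂)
open import Function using (_∘_; id)
open import Relation.Nullary using (yes; no; contradiction)
open import Relation.Binary.PropositionalEquality

Periodic : {A : Set} → ℕ → (ℕ → A) → Set
Periodic n f = ∀ m → f (m + n) ≡ f m

∑ : ℕ → (ℕ → ℕ) → ℕ
∑ zero    f = 0
∑ (suc n) f = f 0 + ∑ n (f ∘ suc)

syntax ∑ n (λ i → e) = ∑[ i < n ] e

∑-cong : ∀ n {f g : ℕ → ℕ} → (∀ i → i < n → f i ≡ g i) → ∑ n f ≡ ∑ n g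
∑-cong zero    eq = refl
∑-cong (suc n) eq = cong₂ _+_ (eq 0 (s≤s z≤n)) (∑-cong n (λ i i<n → eq (suc i) (s≤s i<n)))

∑-const : ∀ n c → ∑[ i < n ] c ≡ n * c
∑-const zero    c = refl
∑-const (suc n) c = cong (c +_) (∑-const n c)

∑-one : ∀ n → ∑[ i < n ] 1 ≡ n
∑-one n = trans (∑-const n 1) (*-identityʳ n)

∑-zero : ∀ n {f : ℕ → ℕ} → (∀ i → i < n → f i ≡ 0) → ∑ n f ≡ 0
∑-zero n eq = trans (∑-cong n eq) (trans (∑-const n 0) (*-zeroʳ n))

∑-+ : ∀ n (f g : ℕ → ℕ) → ∑[ i < n ] (f i + g i) ≡ ∑ n f + ∑ n g
∑-+ zero    f g = refl
∑-+ (suc n) f g = begin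
  f 0 + g 0 + ∑[ i < n ] (f (suc i) + g (suc i))  ≡⟨ cong (f 0 + g 0 +_) (∑-+ n (f ∘ suc) (g ∘ suc)) ⟩
  f 0 + g 0 + (∑ n (f ∘ suc) + ∑ n (g ∘ suc))     ≡⟨ +-+-interchange (f 0) (g 0) _ _ ⟩
  f 0 + ∑ n (f ∘ suc) + (g 0 + ∑ n (g ∘ suc))     ∎
  where
  open ≡-Reasoning
  +-+-interchange : ∀ a b c d → a + b + (c + d) ≡ a + c + (b + d)
  +-+-interchange = solve-∀

∑-*ˡ : ∀ n c (f : ℕ → ℕ) → ∑[ i < n ] (c * f i) ≡ c * ∑ n f
∑-*ˡ zero    c f = sym (*-zeroʳ c)
∑-*ˡ (suc n) c f = trans (cong (c * f 0 +_) (∑-*ˡ n c (f ∘ suc))) (sym (*-distribˡ-+ c (f 0) _))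

∑-split : ∀ m n (f : ℕ → ℕ) → ∑ (m + n) f ≡ ∑ m f + ∑[ i < n ] f (m + i)
∑-split zero    n f = refl
∑-split (suc m) n f = trans (cong (f 0 +_) (∑-split m n (f ∘ suc))) (sym (+-assoc (f 0) _ _))

∑-snoc : ∀ n (f : ℕ → ℕ) → ∑ (suc n) f ≡ ∑ n f + f n
∑-snoc n f = begin
  ∑ (suc n) f               ≡⟨ cong (λ m → ∑ m f) (+-comm 1 n) ⟩
  ∑ (n + 1) f               ≡⟨ ∑-split n 1 f ⟩
  ∑ n f + (f (n + 0) + 0)   ≡⟨ cong (∑ n f +_) (trans (+-identityʳ _) (cong f (+-identityʳ n))) ⟩
  ∑ n f + f n               ∎
  where open ≡-Reasoning

∑-swap : ∀ m n (f : ℕ → ℕ → ℕ) → ∑[ i < m ] ∑[ j < n ] f i j ≡ ∑[ j < n ] ∑[ i < m ] f i j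
∑-swap zero    n f = sym (∑-zero n (λ _ _ → refl))
∑-swap (suc m) n f = trans (cong (∑ n (f 0) +_) (∑-swap m n (f ∘ suc)))
                           (sym (∑-+ n (f 0) (λ j → ∑[ i < m ] f (suc i) j)))

<ᵇ-true : ∀ {m n} → m < n → (m <ᵇ n) ≡ true
<ᵇ-true {zero}  {suc n} _         = refl
<ᵇ-true {suc m} {suc n} (s≤s m<n) = <ᵇ-true m<n

<ᵇ-false : ∀ {m n} → n ≤ m → (m <ᵇ n) ≡ false
<ᵇ-false {m}     {zero}  _         = refl
<ᵇ-false {suc m} {suc n} (s≤s n≤m) = <ᵇ-false n≤m

∑-truncate : ∀ n a (g : ℕ → ℕ) → ∑ (n ∸ a) g ≡ ∑[ i < n ] (⟦ a + i <ᵇ n ⟧ * g i)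
∑-truncate zero    zero    g = refl
∑-truncate zero    (suc a) g = refl
∑-truncate (suc n) zero    g =
  ∑-cong (suc n) (λ i i<n → sym (trans (cong (λ b → ⟦ b ⟧ * g i) (<ᵇ-true i<n))
                                       (+-identityʳ (g i))))
∑-truncate (suc n) (suc a) g = begin
  ∑ (n ∸ a) g                             ≡⟨ ∑-truncate n a g ⟩
  S                                       ≡˘⟨ +-identityʳ S ⟩
  S + ⟦ false ⟧ * g n                     ≡˘⟨ cong (λ b → S + ⟦ b ⟧ * g n) (<ᵇ-false (m≤n+m n a)) ⟩
  S + ⟦ a + n <ᵇ n ⟧ * g n                ≡˘⟨ ∑-snoc n (λ i → ⟦ a + i <ᵇ n ⟧ * g i) ⟩
  ∑[ i < suc n ] (⟦ a + i <ᵇ n ⟧ * g i)   ∎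
  where
  open ≡-Reasoning
  S : ℕ
  S = ∑[ i < n ] (⟦ a + i <ᵇ n ⟧ * g i)

∑-triangle-swap : ∀ n (f : ℕ → ℕ → ℕ) →
  ∑[ i < n ] ∑[ j < n ∸ i ] f i j ≡ ∑[ j < n ] ∑[ i < n ∸ j ] f i j
∑-triangle-swap n f = begin
  ∑[ i < n ] ∑[ j < n ∸ i ] f i j                  ≡⟨ ∑-cong n (λ i _ → ∑-truncate n i (f i)) ⟩
  ∑[ i < n ] ∑[ j < n ] (⟦ i + j <ᵇ n ⟧ * f i j)   ≡⟨ ∑-swap n n _ ⟩
  ∑[ j < n ] ∑[ i < n ] (⟦ i + j <ᵇ n ⟧ * f i j)   ≡⟨ ∑-cong n (λ j _ → ∑-cong n (λ i _ →
                                                        cong (λ m → ⟦ m <ᵇ n ⟧ * f i j) (+-comm i j))) ⟩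
  ∑[ j < n ] ∑[ i < n ] (⟦ j + i <ᵇ n ⟧ * f i j)   ≡˘⟨ ∑-cong n (λ j _ → ∑-truncate n j (λ i → f i j)) ⟩
  ∑[ j < n ] ∑[ i < n ∸ j ] f i j                  ∎
  where open ≡-Reasoning

∑-rotate₁ : ∀ n (f : ℕ → ℕ) → f n ≡ f 0 → ∑ n (f ∘ suc) ≡ ∑ n f
∑-rotate₁ n f fn≡f0 = +-cancelˡ-≡ (f 0) _ _ (begin
  f 0 + ∑ n (f ∘ suc)   ≡⟨ ∑-snoc n f ⟩
  ∑ n f + f n           ≡⟨ cong (∑ n f +_) fn≡f0 ⟩
  ∑ n f + f 0           ≡⟨ +-comm (∑ n f) (f 0) ⟩
  f 0 + ∑ n f           ∎)
  where open ≡-Reasoning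

∑-rotate : ∀ n (f : ℕ → ℕ) → Periodic n f → ∀ r → ∑[ i < n ] f (i + r) ≡ ∑ n f
∑-rotate n f periodic zero    = ∑-cong n (λ i _ → cong f (+-identityʳ i))
∑-rotate n f periodic (suc r) = begin
  ∑[ i < n ] f (i + suc r)     ≡⟨ ∑-cong n (λ i _ → cong f (+-suc i r)) ⟩
  ∑[ i < n ] f (suc i + r)     ≡⟨ ∑-rotate₁ n (λ i → f (i + r)) (trans (cong f (+-comm n r)) (periodic r)) ⟩
  ∑[ i < n ] f (i + r)         ≡⟨ ∑-rotate n f periodic r ⟩
  ∑ n f                        ∎
  where open ≡-Reasoning

∑⟦⟧-witness : ∀ n (b : ℕ → Bool) → ∑[ i < n ] ⟦ b i ⟧ ≡ 0 ⊎ ∃[ i ] (i < n × b i ≡ true)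
∑⟦⟧-witness zero    b = inj₁ refl
∑⟦⟧-witness (suc n) b with b 0 in b0 | ∑⟦⟧-witness n (b ∘ suc)
... | true  | _                   = inj₂ (0 , s≤s z≤n , b0)
... | false | inj₁ rest≡0         = inj₁ rest≡0
... | false | inj₂ (i , i<n , bi) = inj₂ (suc i , s≤s i<n , bi)

ΣFin-∑ : ∀ n (f : Fin n → ℕ) (g : ℕ → ℕ) → (∀ i → f i ≡ g (toℕ i)) → ΣFin n f ≡ ∑ n g
ΣFin-∑ n f g f≗g = trans (cong sum (map-tabulate id f)) (sum-tabulate n f g f≗g)
  where
  sum-tabulate : ∀ n (f : Fin n → ℕ) (g : ℕ → ℕ) → (∀ i → f i ≡ g (toℕ i)) → sum (tabulate f) ≡ ∑ n g
  sum-tabulate zero    f g f≗g = refl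
  sum-tabulate (suc n) f g f≗g =
    cong₂ _+_ (f≗g Fin.zero) (sum-tabulate n (f ∘ Fin.suc) (g ∘ suc) (f≗g ∘ Fin.suc))

-- Colour changes along a path

⟦⟧-+ : ∀ a b → ⟦ a ⟧ + ⟦ b ⟧ ≡ ⟦ a xor b ⟧ + 2 * ⟦ a ∧ b ⟧
⟦⟧-+ true  true  = refl
⟦⟧-+ true  false = refl
⟦⟧-+ false b     = sym (+-identityʳ ⟦ b ⟧)

⟦xor⟧≡0 : ∀ a b → ⟦ a xor b ⟧ ≡ 0 → a ≡ b
⟦xor⟧≡0 true  true  _ = refl
⟦xor⟧≡0 false false _ = refl

xor-cancel-middle : ∀ a b c → (a xor b) xor (b xor c) ≡ a xor c
xor-cancel-middle a b c = begin
  (a xor b) xor (b xor c)  ≡⟨ xor-assoc a b (b xor c) ⟩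
  a xor (b xor (b xor c))  ≡˘⟨ cong (a xor_) (xor-assoc b b c) ⟩
  a xor ((b xor b) xor c)  ≡⟨ cong (λ x → a xor (x xor c)) (xor-same b) ⟩
  a xor c                  ∎
  where open ≡-Reasoning

disagreements : ℕ → ℕ → (ℕ → Bool) → ℕ
disagreements d L q = ∑[ i < L ] ⟦ q i xor q (d + i) ⟧

changes : ℕ → (ℕ → Bool) → ℕ
changes = disagreements 1

changes-parity : ∀ L q → ∃[ t ] changes L q ≡ ⟦ q 0 xor q L ⟧ + 2 * t
changes-parity zero    q = 0 , cong (λ b → ⟦ b ⟧ + 0) (sym (xor-same (q 0)))
changes-parity (suc L) q with changes-parity L (q ∘ suc)
... | t , eq = ⟦ a ∧ b ⟧ + t , (begin
  ⟦ a ⟧ + changes L (q ∘ suc)              ≡⟨ cong (⟦ a ⟧ +_) eq ⟩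
  ⟦ a ⟧ + (⟦ b ⟧ + 2 * t)                  ≡˘⟨ +-assoc ⟦ a ⟧ ⟦ b ⟧ _ ⟩
  ⟦ a ⟧ + ⟦ b ⟧ + 2 * t                    ≡⟨ cong (_+ 2 * t) (⟦⟧-+ a b) ⟩
  ⟦ a xor b ⟧ + 2 * ⟦ a ∧ b ⟧ + 2 * t      ≡⟨ regroup ⟦ a xor b ⟧ ⟦ a ∧ b ⟧ t ⟩
  ⟦ a xor b ⟧ + 2 * (⟦ a ∧ b ⟧ + t)        ≡⟨ cong (λ x → ⟦ x ⟧ + 2 * (⟦ a ∧ b ⟧ + t)) a-xor-b ⟩
  ⟦ q 0 xor q (suc L) ⟧ + 2 * (⟦ a ∧ b ⟧ + t) ∎)
  where
  open ≡-Reasoning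
  a b : Bool
  a = q 0 xor q 1
  b = q 1 xor q (suc L)
  a-xor-b : a xor b ≡ q 0 xor q (suc L)
  a-xor-b = xor-cancel-middle (q 0) (q 1) (q (suc L))
  regroup : ∀ x y z → x + 2 * y + 2 * z ≡ x + 2 * (y + z)
  regroup = solve-∀

changes≡0⇒constant : ∀ L q → changes L q ≡ 0 → ∀ i → i ≤ L → q i ≡ q 0
changes≡0⇒constant L       q _  zero    _         = refl
changes≡0⇒constant (suc L) q eq (suc i) (s≤s i≤L) =
  trans (changes≡0⇒constant L (q ∘ suc) (m+n≡0⇒n≡0 ⟦ q 0 xor q 1 ⟧ eq) i i≤L)
        (sym (⟦xor⟧≡0 (q 0) (q 1) (m+n≡0⇒m≡0 ⟦ q 0 xor q 1 ⟧ eq)))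

-- Periodic colourings

boundary : (ℕ → Bool) → ℕ → Bool
boundary y i = y i xor y (suc i)

-- vertex suc i has a colour different from both of its neighbours
isolated : (ℕ → Bool) → ℕ → Bool
isolated y i = boundary y i ∧ boundary y (suc i)

-- the cut of C_n^2 by a colouring y of period n
cyclicCut : ℕ → (ℕ → Bool) → ℕ
cyclicCut n y = disagreements 1 n y + disagreements 2 n y

offColour : ℕ → (ℕ → Bool) → Bool → ℕ
offColour n y c = ∑[ i < n ] ⟦ y i xor c ⟧

cyclicCut≡changes+changes : ∀ n y → cyclicCut n y ≡ changes n y + changes n (boundary y)
cyclicCut≡changes+changes n y = cong (changes n y +_)
  (∑-cong n (λ i _ → cong ⟦_⟧ (sym (xor-cancel-middle (y i) (y (suc i)) (y (suc (suc i)))))))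

boundary-periodic : ∀ {n} y → Periodic n y → Periodic n (boundary y)
boundary-periodic y periodic i = cong₂ _xor_ (periodic i) (periodic (suc i))

cyclic-changes-even : ∀ n y → Periodic n y → ∃[ t ] changes n y ≡ 2 * t
cyclic-changes-even n y periodic with changes-parity n y
... | t , eq = t , trans eq (cong (λ b → ⟦ b ⟧ + 2 * t) y0-xor-yn)
  where
  y0-xor-yn : y 0 xor y n ≡ false
  y0-xor-yn = trans (cong (y 0 xor_) (periodic 0)) (xor-same (y 0))

changes-double : ∀ n y → Periodic n y →
  changes n y + changes n y ≡ changes n (boundary y) + 2 * ∑[ i < n ] ⟦ isolated y i ⟧
changes-double n y periodic = begin
  changes n y + changes n y
    ≡˘⟨ cong (_+ changes n y) (∑-rotate₁ n b (cong ⟦_⟧ (boundary-periodic y periodic 0))) ⟩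
  ∑[ i < n ] b (suc i) + ∑[ i < n ] b i
    ≡˘⟨ ∑-+ n (b ∘ suc) b ⟩
  ∑[ i < n ] (b (suc i) + b i)
    ≡⟨ ∑-cong n (λ i _ → +-comm (b (suc i)) (b i)) ⟩
  ∑[ i < n ] (b i + b (suc i))
    ≡⟨ ∑-cong n (λ i _ → ⟦⟧-+ (boundary y i) (boundary y (suc i))) ⟩
  ∑[ i < n ] (⟦ boundary y i xor boundary y (suc i) ⟧ + 2 * ⟦ isolated y i ⟧)
    ≡⟨ ∑-+ n _ _ ⟩
  changes n (boundary y) + ∑[ i < n ] (2 * ⟦ isolated y i ⟧)
    ≡⟨ cong (changes n (boundary y) +_) (∑-*ˡ n 2 _) ⟩
  changes n (boundary y) + 2 * ∑[ i < n ] ⟦ isolated y i ⟧ ∎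
  where
  open ≡-Reasoning
  b : ℕ → ℕ
  b i = ⟦ boundary y i ⟧

changes≡0⇒∑-constant : ∀ n q (g : Bool → ℕ) → changes n q ≡ 0 → ∑[ i < n ] g (q i) ≡ n * g (q 0)
changes≡0⇒∑-constant n q g eq = trans
  (∑-cong n (λ i i<n → cong g (changes≡0⇒constant n q eq i (<⇒≤ i<n))))
  (∑-const n (g (q 0)))

changes≡0⇒monochromatic : ∀ n y → changes n y ≡ 0 → offColour n y (y 0) ≡ 0
changes≡0⇒monochromatic n y eq = trans (changes≡0⇒∑-constant n y (λ b → ⟦ b xor y 0 ⟧) eq)
                                       (trans (cong (λ b → n * ⟦ b ⟧) (xor-same (y 0))) (*-zeroʳ n))

module _ {n : ℕ} (y : ℕ → Bool) (periodic : Periodic n y) (r : ℕ) where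

  private
    z : ℕ → Bool
    z i = y (i + r)

  rotate-periodic : Periodic n z
  rotate-periodic i = trans (cong y (swap i n r)) (periodic (i + r))
    where
    swap : ∀ i n r → i + n + r ≡ i + r + n
    swap = solve-∀

  rotate-changes : changes n z ≡ changes n y
  rotate-changes =
    ∑-rotate n (λ i → ⟦ boundary y i ⟧) (λ i → cong ⟦_⟧ (boundary-periodic y periodic i)) r

  rotate-offColour : ∀ c → offColour n z c ≡ offColour n y c
  rotate-offColour c =
    ∑-rotate n (λ i → ⟦ y i xor c ⟧) (λ i → cong (λ b → ⟦ b xor c ⟧) (periodic i)) r

isolated⇒singleton-class : ∀ n z → Periodic (2 + n) z → changes (2 + n) z ≡ 2 →
  isolated z 0 ≡ true → offColour (2 + n) z (z 2) ≡ 1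
isolated⇒singleton-class n z periodic two iso = begin
  ⟦ z 0 xor z 2 ⟧ + (⟦ z 1 xor z 2 ⟧ + ∑[ i < n ] ⟦ z (2 + i) xor z 2 ⟧)
      ≡⟨ cong₂ (λ a b → ⟦ a ⟧ + (⟦ b ⟧ + ∑[ i < n ] ⟦ z (2 + i) xor z 2 ⟧))
               (trans (cong (_xor z 2) z0≡z2) (xor-same (z 2))) b₁ ⟩
  1 + ∑[ i < n ] ⟦ z (2 + i) xor z 2 ⟧
      ≡⟨ cong suc (changes≡0⇒∑-constant n tail (λ b → ⟦ b xor z 2 ⟧) rest≡0) ⟩
  1 + n * ⟦ z 2 xor z 2 ⟧
      ≡⟨ cong (λ b → 1 + n * ⟦ b ⟧) (xor-same (z 2)) ⟩
  1 + n * 0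
      ≡⟨ cong suc (*-zeroʳ n) ⟩
  1   ∎
  where
  open ≡-Reasoning
  tail : ℕ → Bool
  tail i = z (2 + i)
  ∧-true : ∀ {a b} → a ∧ b ≡ true → a ≡ true × b ≡ true
  ∧-true {true} {true} _ = refl , refl
  b₀ : z 0 xor z 1 ≡ true
  b₀ = proj₁ (∧-true iso)
  b₁ : z 1 xor z 2 ≡ true
  b₁ = proj₂ (∧-true iso)
  rest≡0 : changes n tail ≡ 0
  rest≡0 = suc-injective (suc-injective
    (trans (sym (cong₂ (λ a b → ⟦ a ⟧ + (⟦ b ⟧ + changes n tail)) b₀ b₁)) two))
  z0≡z2 : z 0 ≡ z 2
  z0≡z2 = trans (sym (periodic 0)) (changes≡0⇒constant n tail rest≡0 n ≤-refl)

two-changes⇒no-isolated : ∀ n y → Periodic (2 + n) y → (∀ c → 2 ≤ offColour (2 + n) y c) →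
  changes (2 + n) y ≡ 2 → ∑[ i < 2 + n ] ⟦ isolated y i ⟧ ≡ 0
two-changes⇒no-isolated n y periodic classes≥2 two with ∑⟦⟧-witness (2 + n) (isolated y)
... | inj₁ none            = none
... | inj₂ (r , _ , iso)   = ⊥-elim (<⇒≱ (s≤s ≤-refl) (subst (2 ≤_) small (classes≥2 (y (2 + r)))))
  where
  small : offColour (2 + n) y (y (2 + r)) ≡ 1
  small = trans (sym (rotate-offColour y periodic r (y (2 + r))))
                (isolated⇒singleton-class n (λ i → y (i + r)) (rotate-periodic y periodic r)
                             (trans (rotate-changes y periodic r) two) iso)

cyclicCut-lowerBound : ∀ n y → Periodic n y → 6 ≤ n → (∀ c → 2 ≤ offColour n y c) →
  6 ≤ cyclicCut n y
cyclicCut-lowerBound N@(suc (suc n)) y periodic 6≤N@(s≤s (s≤s _)) classes≥2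
  rewrite cyclicCut≡changes+changes N y
  with cyclic-changes-even N y periodic | cyclic-changes-even N (boundary y) (boundary-periodic y periodic)
... | zero , B≡0 | _ =
  ⊥-elim (<⇒≱ (s≤s z≤n) (subst (2 ≤_) (changes≡0⇒monochromatic N y B≡0) (classes≥2 (y 0))))
... | suc zero , B≡2 | _ = ≤-reflexive (sym (cong₂ _+_ B≡2 C≡4))
  where
  I≡0 : ∑[ i < N ] ⟦ isolated y i ⟧ ≡ 0
  I≡0 = two-changes⇒no-isolated n y periodic classes≥2 B≡2
  C≡4 : changes N (boundary y) ≡ 4
  C≡4 = begin
    C                                            ≡˘⟨ +-identityʳ C ⟩
    C + 2 * 0                                    ≡˘⟨ cong (λ x → C + 2 * x) I≡0 ⟩
    C + 2 * ∑[ i < N ] ⟦ isolated y i ⟧          ≡˘⟨ changes-double N y periodic ⟩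
    changes N y + changes N y                    ≡⟨ cong₂ _+_ B≡2 B≡2 ⟩
    4                                            ∎
    where
    open ≡-Reasoning
    C : ℕ
    C = changes N (boundary y)
... | suc (suc β) , B≡4+ | zero , C≡0 =
  all-or-no-boundaries (boundary y 0) (changes≡0⇒∑-constant N (boundary y) ⟦_⟧ C≡0)
  where
  all-or-no-boundaries : ∀ b → changes N y ≡ N * ⟦ b ⟧ → 6 ≤ changes N y + changes N (boundary y)
  all-or-no-boundaries true  B≡N = ≤-trans 6≤N (≤-trans (≤-reflexive (sym (trans B≡N (*-identityʳ N))))
                                                       (m≤m+n (changes N y) _))
  all-or-no-boundaries false B≡0 with () ← trans (sym B≡4+) (trans B≡0 (*-zeroʳ N))
... | suc (suc β) , B≡4+ | suc γ , C≡2+ rewrite B≡4+ | C≡2+ =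
  subst (6 ≤_) (sym (regroup β γ)) (m≤m+n 6 _)
  where
  regroup : ∀ β γ → 2 * suc (suc β) + 2 * suc γ ≡ 6 + (2 * β + 2 * γ)
  regroup = solve-∀

-- The edges of C_n^2 grouped by offset

≡ᵇ-refl : ∀ n → (n ≡ᵇ n) ≡ true
≡ᵇ-refl zero    = refl
≡ᵇ-refl (suc n) = ≡ᵇ-refl n

<⇒≡ᵇ-false : ∀ {m n} → m < n → (m ≡ᵇ n) ≡ false
<⇒≡ᵇ-false {zero}  {suc n} _         = refl
<⇒≡ᵇ-false {suc m} {suc n} (s≤s m<n) = <⇒≡ᵇ-false m<n

sqOffset : ℕ → ℕ → Bool
sqOffset n d = (d ≡ᵇ 1) ∨ (d ≡ᵇ 2) ∨ (d ≡ᵇ (n ∸ 1)) ∨ (d ≡ᵇ (n ∸ 2))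

pairCut : ℕ → (ℕ → Bool) → ℕ → ℕ → ℕ
pairCut m q a b =
  ⟦ (a <ᵇ b) ∧ (not (a ≡ᵇ b) ∧ sqOffset (suc m) ((suc m + b ∸ a) % suc m)) ∧ (q a xor q b) ⟧

cutSq-∑ : ∀ m (p : Fin (suc m) → Bool) q → (∀ i → p i ≡ q (toℕ i)) →
  cutSq (suc m) p ≡ ∑[ a < suc m ] ∑[ b < suc m ] pairCut m q a b
cutSq-∑ m p q p≗q =
  ΣFin-∑ (suc m) _ (λ a → ∑[ b < suc m ] pairCut m q a b)
         (λ i → ΣFin-∑ (suc m) _ (pairCut m q (toℕ i)) (pair i))
  where
  pair : ∀ i j →
    ⟦ (toℕ i <ᵇ toℕ j) ∧ sqAdj (suc m) i j ∧ (p i xor p j) ⟧ ≡ pairCut m q (toℕ i) (toℕ j)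
  pair i j rewrite p≗q i | p≗q j = refl

offset-mod : ∀ m a e → suc e ≤ m → (suc m + (suc a + e) ∸ a) % suc m ≡ suc e
offset-mod m a e e<m = begin
  (suc m + (suc a + e) ∸ a) % suc m   ≡⟨ cong (λ x → (x ∸ a) % suc m) (shuffle m a e) ⟩
  (suc e + suc m + a ∸ a) % suc m     ≡⟨ cong (_% suc m) (m+n∸n≡m (suc e + suc m) a) ⟩
  (suc e + suc m) % suc m             ≡⟨ [m+n]%n≡m%n (suc e) (suc m) ⟩
  suc e % suc m                       ≡⟨ m<n⇒m%n≡m (s≤s e<m) ⟩
  suc e                               ∎
  where
  open ≡-Reasoning
  shuffle : ∀ m a e → suc m + (suc a + e) ≡ suc e + suc m + a
  shuffle = solve-∀

pairCut-row : ∀ m q a → a ≤ m →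
  ∑[ b < suc m ] pairCut m q a b
    ≡ ∑[ e < m ∸ a ] (⟦ sqOffset (suc m) (suc e) ⟧ * ⟦ q a xor q (suc e + a) ⟧)
pairCut-row m q a a≤m = begin
  ∑[ b < suc m ] pairCut m q a b
    ≡˘⟨ cong (λ n → ∑[ b < n ] pairCut m q a b) (cong suc (m+[n∸m]≡n a≤m)) ⟩
  ∑[ b < suc a + (m ∸ a) ] pairCut m q a b
    ≡⟨ ∑-split (suc a) (m ∸ a) (pairCut m q a) ⟩
  ∑[ b < suc a ] pairCut m q a b + ∑[ e < m ∸ a ] pairCut m q a (suc a + e)
    ≡⟨ cong₂ _+_ (∑-zero (suc a) (λ b b≤a → below b b≤a)) (∑-cong (m ∸ a) above) ⟩
  ∑[ e < m ∸ a ] (⟦ sqOffset (suc m) (suc e) ⟧ * ⟦ q a xor q (suc e + a) ⟧) ∎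
  where
  open ≡-Reasoning
  below : ∀ b → b < suc a → pairCut m q a b ≡ 0
  below b (s≤s b≤a) rewrite <ᵇ-false {a} {b} b≤a = refl
  above : ∀ e → e < m ∸ a →
    pairCut m q a (suc a + e) ≡ ⟦ sqOffset (suc m) (suc e) ⟧ * ⟦ q a xor q (suc e + a) ⟧
  above e e<m∸a
    rewrite <ᵇ-true (s≤s (m≤m+n a e)) | <⇒≡ᵇ-false (s≤s (m≤m+n a e))
          | offset-mod m a e (≤-trans e<m∸a (m∸n≤m m a)) | +-comm a e
    = ∧-⟦⟧ (sqOffset (suc m) (suc e)) (q a xor q (suc (e + a)))
    where
    ∧-⟦⟧ : ∀ u v → ⟦ u ∧ v ⟧ ≡ ⟦ u ⟧ * ⟦ v ⟧
    ∧-⟦⟧ true  v = sym (+-identityʳ ⟦ v ⟧)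
    ∧-⟦⟧ false v = refl

cutSq-offsets : ∀ m p q → (∀ i → p i ≡ q (toℕ i)) →
  cutSq (suc m) p ≡ ∑[ e < m ] (⟦ sqOffset (suc m) (suc e) ⟧ * disagreements (suc e) (m ∸ e) q)
cutSq-offsets m p q p≗q = begin
  cutSq (suc m) p
    ≡⟨ cutSq-∑ m p q p≗q ⟩
  ∑[ a < suc m ] ∑[ b < suc m ] pairCut m q a b
    ≡⟨ ∑-cong (suc m) (λ a a<1+m → pairCut-row m q a (≤-pred a<1+m)) ⟩
  ∑[ a < suc m ] ∑[ e < m ∸ a ] F a e
    ≡⟨ ∑-snoc m (λ a → ∑[ e < m ∸ a ] F a e) ⟩
  T + ∑[ e < m ∸ m ] F m e
    ≡⟨ cong (λ n → T + ∑[ e < n ] F m e) (n∸n≡0 m) ⟩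
  T + 0
    ≡⟨ +-identityʳ T ⟩
  T
    ≡⟨ ∑-triangle-swap m F ⟩
  ∑[ e < m ] ∑[ a < m ∸ e ] F a e
    ≡⟨ ∑-cong m (λ e _ → ∑-*ˡ (m ∸ e) (o e) (λ a → ⟦ q a xor q (suc e + a) ⟧)) ⟩
  ∑[ e < m ] (o e * disagreements (suc e) (m ∸ e) q) ∎
  where
  open ≡-Reasoning
  o : ℕ → ℕ
  o e = ⟦ sqOffset (suc m) (suc e) ⟧
  F : ℕ → ℕ → ℕ
  F a e = o e * ⟦ q a xor q (suc e + a) ⟧
  T : ℕ
  T = ∑[ a < m ] ∑[ e < m ∸ a ] F a e

sqOffset-select : ∀ k (W : ℕ → ℕ) →
  ∑[ e < 4 + k ] (⟦ sqOffset (5 + k) (suc e) ⟧ * W e) ≡ W 0 + W 1 + W (2 + k) + W (3 + k)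
sqOffset-select k W = begin
  (W 0 + 0) + ((W 1 + 0) + ∑[ i < 2 + k ] g i)     ≡⟨ cong (λ x → (W 0 + 0) + ((W 1 + 0) + x)) far ⟩
  (W 0 + 0) + ((W 1 + 0) + (W (2 + k) + W (3 + k))) ≡⟨ regroup (W 0) (W 1) (W (2 + k)) (W (3 + k)) ⟩
  W 0 + W 1 + W (2 + k) + W (3 + k)                ∎
  where
  open ≡-Reasoning
  g : ℕ → ℕ
  g i = ⟦ sqOffset (5 + k) (3 + i) ⟧ * W (2 + i)
  g-small : ∀ i → i < k → g i ≡ 0
  g-small i i<k rewrite <⇒≡ᵇ-false (m<n⇒m<1+n i<k) | <⇒≡ᵇ-false i<k = refl
  far : ∑[ i < 2 + k ] g i ≡ W (2 + k) + W (3 + k)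
  far rewrite ∑-snoc (suc k) g | ∑-snoc k g | ∑-zero k g-small
            | <⇒≡ᵇ-false (n<1+n k) | ≡ᵇ-refl k
            = cong₂ _+_ (*-identityˡ (W (2 + k))) (*-identityˡ (W (3 + k)))
  regroup : ∀ a b c d → (a + 0) + ((b + 0) + (c + d)) ≡ a + b + c + d
  regroup = solve-∀

cutSq-four-diagonals : ∀ k p q → (∀ i → p i ≡ q (toℕ i)) →
  cutSq (5 + k) p ≡ disagreements 1 (4 + k) q + disagreements 2 (3 + k) q
                  + disagreements (3 + k) 2 q + disagreements (4 + k) 1 q
cutSq-four-diagonals k p q p≗q = trans (cutSq-offsets (4 + k) p q p≗q)
  (trans (sqOffset-select k (λ e → disagreements (suc e) ((4 + k) ∸ e) q))
         (cong₂ (λ x y → disagreements 1 (4 + k) q + disagreements 2 (3 + k) q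
                         + disagreements (3 + k) x q + disagreements (4 + k) y q)
                (m+n∸n≡m 2 k) (m+n∸n≡m 1 k)))

cyclicCut-four-diagonals : ∀ k y → Periodic (5 + k) y →
  cyclicCut (5 + k) y ≡ disagreements 1 (4 + k) y + disagreements 2 (3 + k) y
                      + disagreements (3 + k) 2 y + disagreements (4 + k) 1 y
cyclicCut-four-diagonals k y periodic = begin
  disagreements 1 (5 + k) y + disagreements 2 (5 + k) y
    ≡⟨ cong₂ _+_ (∑-snoc (4 + k) f₁)
                 (trans (∑-snoc (4 + k) f₂) (cong (_+ f₂ (4 + k)) (∑-snoc (3 + k) f₂))) ⟩
  (D₁ + f₁ (4 + k)) + (D₂ + f₂ (3 + k) + f₂ (4 + k))
    ≡⟨ regroup D₁ D₂ (f₁ (4 + k)) (f₂ (3 + k)) (f₂ (4 + k)) ⟩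
  D₁ + D₂ + (f₂ (3 + k) + f₂ (4 + k)) + f₁ (4 + k)
    ≡˘⟨ cong₂ (λ x z → D₁ + D₂ + x + z) third fourth ⟩
  D₁ + D₂ + disagreements (3 + k) 2 y + disagreements (4 + k) 1 y ∎
  where
  open ≡-Reasoning
  f₁ f₂ : ℕ → ℕ
  f₁ i = ⟦ y i xor y (1 + i) ⟧
  f₂ i = ⟦ y i xor y (2 + i) ⟧
  D₁ D₂ : ℕ
  D₁ = disagreements 1 (4 + k) y
  D₂ = disagreements 2 (3 + k) y
  wrap : ∀ i j → ⟦ y i xor y j ⟧ ≡ ⟦ y j xor y (i + (5 + k)) ⟧
  wrap i j = cong ⟦_⟧ (trans (xor-comm (y i) (y j)) (cong (y j xor_) (sym (periodic i))))
  third : disagreements (3 + k) 2 y ≡ f₂ (3 + k) + f₂ (4 + k)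
  third = cong₂ _+_
    (trans (cong (λ m → ⟦ y 0 xor y m ⟧) (+-identityʳ (3 + k))) (wrap 0 (3 + k)))
    (trans (+-identityʳ _) (trans (cong (λ m → ⟦ y 1 xor y m ⟧) (+-comm (3 + k) 1)) (wrap 1 (4 + k))))
  fourth : disagreements (4 + k) 1 y ≡ f₁ (4 + k)
  fourth = trans (+-identityʳ _) (trans (cong (λ m → ⟦ y 0 xor y m ⟧) (+-identityʳ (4 + k))) (wrap 0 (4 + k)))
  regroup : ∀ a b c d e → (a + c) + (b + d + e) ≡ a + b + (d + e) + c
  regroup = solve-∀

-- Balanced partitions

∑-threshold : ∀ h n → h ≤ n → ∑[ i < n ] ⟦ i <ᵇ h ⟧ ≡ h
∑-threshold h n h≤n with r , refl ← m≤n⇒∃[o]m+o≡n h≤n = begin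
  ∑[ i < h + r ] ⟦ i <ᵇ h ⟧                              ≡⟨ ∑-split h r _ ⟩
  ∑[ i < h ] ⟦ i <ᵇ h ⟧ + ∑[ i < r ] ⟦ h + i <ᵇ h ⟧      ≡⟨ cong₂ _+_ (∑-cong h (λ i i<h → cong ⟦_⟧ (<ᵇ-true i<h)))
                                                                     (∑-zero r (λ i _ → cong ⟦_⟧ (<ᵇ-false (m≤m+n h i)))) ⟩
  ∑[ i < h ] 1 + 0                                       ≡⟨ trans (+-identityʳ _) (∑-one h) ⟩
  h                                                      ∎
  where open ≡-Reasoning

threshold-near : ∀ d h L → d ≤ h → h ≤ L → disagreements d L (_<ᵇ h) ≡ d
threshold-near d h L d≤h h≤L
  with o , refl ← m≤n⇒∃[o]m+o≡n d≤h | r , refl ← m≤n⇒∃[o]m+o≡n h≤L = begin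
  ∑[ i < d + o + r ] f i                                      ≡⟨ ∑-split (d + o) r f ⟩
  ∑[ i < d + o ] f i + ∑[ i < r ] f (d + o + i)               ≡⟨ cong (λ n → ∑ n f + tail) (+-comm d o) ⟩
  ∑[ i < o + d ] f i + ∑[ i < r ] f (d + o + i)               ≡⟨ cong (_+ tail) (∑-split o d f) ⟩
  ∑[ i < o ] f i + ∑[ i < d ] f (o + i) + ∑[ i < r ] f (d + o + i)
    ≡⟨ cong₂ _+_ (cong₂ _+_ (∑-zero o before) (∑-cong d crossing)) (∑-zero r after) ⟩
  ∑[ i < d ] 1 + 0                                            ≡⟨ trans (+-identityʳ _) (∑-one d) ⟩
  d                                                           ∎
  where
  open ≡-Reasoning
  f : ℕ → ℕ
  f i = ⟦ (i <ᵇ d + o) xor (d + i <ᵇ d + o) ⟧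
  tail : ℕ
  tail = ∑[ i < r ] f (d + o + i)
  before : ∀ i → i < o → f i ≡ 0
  before i i<o rewrite <ᵇ-true (≤-trans i<o (m≤n+m o d)) | <ᵇ-true (+-monoʳ-< d i<o) = refl
  crossing : ∀ i → i < d → f (o + i) ≡ 1
  crossing i i<d rewrite <ᵇ-true (subst (o + i <_) (+-comm o d) (+-monoʳ-< o i<d))
                       | <ᵇ-false (+-monoʳ-≤ d (m≤m+n o i)) = refl
  after : ∀ i → i < r → f (d + o + i) ≡ 0
  after i _ rewrite <ᵇ-false (m≤m+n (d + o) i)
                  | <ᵇ-false (≤-trans (m≤m+n (d + o) i) (m≤n+m (d + o + i) d)) = refl

threshold-far : ∀ d h L → L ≤ h → h ≤ d → disagreements d L (_<ᵇ h) ≡ L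
threshold-far d h L L≤h h≤d = trans (∑-cong L every) (∑-one L)
  where
  every : ∀ i → i < L → ⟦ (i <ᵇ h) xor (d + i <ᵇ h) ⟧ ≡ 1
  every i i<L rewrite <ᵇ-true (≤-trans i<L L≤h) | <ᵇ-false (≤-trans h≤d (m≤m+n d i)) = refl

threshold-cutSq : ∀ k h → 2 ≤ h → h ≤ 3 + k → cutSq (5 + k) (λ i → toℕ i <ᵇ h) ≡ 6
threshold-cutSq k h 2≤h h≤3+k = trans (cutSq-four-diagonals k _ (_<ᵇ h) (λ _ → refl))
  (cong₂ _+_ (cong₂ _+_ (cong₂ _+_ (threshold-near 1 h (4 + k) 1≤h (m≤n⇒m≤1+n h≤3+k))
                                   (threshold-near 2 h (3 + k) 2≤h h≤3+k))
                        (threshold-far (3 + k) h 2 2≤h h≤3+k))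
             (threshold-far (4 + k) h 1 1≤h (m≤n⇒m≤1+n h≤3+k)))
  where
  1≤h : 1 ≤ h
  1≤h = ≤-trans (s≤s z≤n) 2≤h

3≤balanced-part : ∀ a b → 6 ≤ a + b → b ≤ suc a → 3 ≤ a
3≤balanced-part a b 6≤a+b b≤1+a with 3 ≤? a
... | yes 3≤a = 3≤a
... | no  3≰a = contradiction (≤-trans 6≤a+b (+-mono-≤ a≤2 (≤-trans b≤1+a (s≤s a≤2)))) (<⇒≱ (n<1+n 5))
  where
  a≤2 : a ≤ 2
  a≤2 = ≤-pred (≰⇒> 3≰a)

∑-complement : ∀ n (b : ℕ → Bool) → ∑[ i < n ] ⟦ b i ⟧ + ∑[ i < n ] ⟦ not (b i) ⟧ ≡ n
∑-complement n b = begin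
  ∑[ i < n ] ⟦ b i ⟧ + ∑[ i < n ] ⟦ not (b i) ⟧   ≡˘⟨ ∑-+ n _ _ ⟩
  ∑[ i < n ] (⟦ b i ⟧ + ⟦ not (b i) ⟧)            ≡⟨ ∑-cong n (λ i _ → one (b i)) ⟩
  ∑[ i < n ] 1                                    ≡⟨ ∑-one n ⟩
  n                                               ∎
  where
  open ≡-Reasoning
  one : ∀ b → ⟦ b ⟧ + ⟦ not b ⟧ ≡ 1
  one true  = refl
  one false = refl

module _ {n : ℕ} (p : Fin n → Bool) (y : ℕ → Bool) (p≗y : ∀ i → p i ≡ y (toℕ i)) where

  sizeA-∑ : sizeA n p ≡ ∑[ i < n ] ⟦ y i ⟧
  sizeA-∑ = ΣFin-∑ n _ _ (cong ⟦_⟧ ∘ p≗y)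

  sizeB-∑ : sizeB n p ≡ ∑[ i < n ] ⟦ not (y i) ⟧
  sizeB-∑ = ΣFin-∑ n _ _ (cong (⟦_⟧ ∘ not) ∘ p≗y)

  sizeA+sizeB : sizeA n p + sizeB n p ≡ n
  sizeA+sizeB = trans (cong₂ _+_ sizeA-∑ sizeB-∑) (∑-complement n y)

  balanced⇒offColour≥3 : 6 ≤ n → Balanced n p → ∀ c → 3 ≤ offColour n y c
  balanced⇒offColour≥3 6≤n (A≤1+B , B≤1+A) true  =
    subst (3 ≤_) (trans sizeB-∑ (∑-cong n (λ i _ → cong ⟦_⟧ (xor-comm true (y i)))))
          (3≤balanced-part _ _ (subst (6 ≤_) (trans (sym sizeA+sizeB) (+-comm (sizeA n p) (sizeB n p))) 6≤n) A≤1+B)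
  balanced⇒offColour≥3 6≤n (A≤1+B , B≤1+A) false =
    subst (3 ≤_) (trans sizeA-∑ (∑-cong n (λ i _ → cong ⟦_⟧ (sym (xor-identityʳ (y i))))))
          (3≤balanced-part _ _ (subst (6 ≤_) (sym sizeA+sizeB) 6≤n) B≤1+A)

  half-balanced : sizeA n p ≡ ⌊ n /2⌋ → Balanced n p
  half-balanced A≡⌊n/2⌋ =
      subst₂ _≤_ (sym A≡⌊n/2⌋) (cong suc (sym B≡⌈n/2⌉)) (≤-trans (⌊n/2⌋≤⌈n/2⌉ n) (n≤1+n _))
    , subst₂ _≤_ (sym B≡⌈n/2⌉) (cong suc (sym A≡⌊n/2⌋)) (⌊n/2⌋-mono (n≤1+n (suc n)))
    where
    B≡⌈n/2⌉ : sizeB n p ≡ ⌈ n /2⌉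
    B≡⌈n/2⌉ = +-cancelˡ-≡ ⌊ n /2⌋ _ _ (trans (cong (_+ sizeB n p) (sym A≡⌊n/2⌋))
                                           (trans sizeA+sizeB (sym (⌊n/2⌋+⌈n/2⌉≡n n))))

module _ (n : ℕ) .{{_ : NonZero n}} (p : Fin n → Bool) where

  mod-extension : ∀ i → p i ≡ p (toℕ i mod n)
  mod-extension i =
    cong p (sym (trans (fromℕ<-cong _ _ (m<n⇒m%n≡m (toℕ<n i)) _ (toℕ<n i)) (fromℕ<-toℕ i _)))

  mod-periodic : Periodic n (λ i → p (i mod n))
  mod-periodic i = cong p (fromℕ<-cong _ _ ([m+n]%n≡m%n i n) _ _)

upperBound : ∀ k → Σ (Fin (5 + k) → Bool) (λ p → Balanced (5 + k) p × cutSq (5 + k) p ≡ 6)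
upperBound k = p , half-balanced p (_<ᵇ h) (λ _ → refl) A≡h
                 , threshold-cutSq k h (s≤s (s≤s z≤n)) (s≤s (s≤s (⌊n/2⌋≤n (suc k))))
  where
  h : ℕ
  h = ⌊ 5 + k /2⌋
  p : Fin (5 + k) → Bool
  p i = toℕ i <ᵇ h
  A≡h : sizeA (5 + k) p ≡ h
  A≡h = trans (sizeA-∑ p (_<ᵇ h) (λ _ → refl)) (∑-threshold h (5 + k) (⌊n/2⌋≤n (5 + k)))

lowerBound : ∀ k (p : Fin (6 + k) → Bool) → Balanced (6 + k) p → 6 ≤ cutSq (6 + k) p
lowerBound k p balanced = subst (6 ≤_) (sym cut≡)
  (cyclicCut-lowerBound N y (mod-periodic N p) 6≤N
    (λ c → ≤-trans (n≤1+n 2) (balanced⇒offColour≥3 p y (mod-extension N p) 6≤N balanced c)))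
  where
  N : ℕ
  N = 6 + k
  6≤N : 6 ≤ N
  6≤N = m≤m+n 6 k
  y : ℕ → Bool
  y i = p (i mod N)
  cut≡ : cutSq N p ≡ cyclicCut N y
  cut≡ = trans (cutSq-four-diagonals (suc k) p y (mod-extension N p))
               (sym (cyclicCut-four-diagonals (suc k) y (mod-periodic N p)))

theorem3p3 : (n : ℕ) → 6 ≤ n → RnaSqIs n 6
theorem3p3 n 6≤n with k , refl ← m≤n⇒∃[o]m+o≡n 6≤n = upperBound (suc k) , lowerBound k
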